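{- For each integer $k\ge 1$, let $L_k(x)=\sum_{n\ge1}\ell_k(n)x^n$, where $\ell_k(n)$ is the total number of vertices having exactly $k$ leaves in their subtree, summed over all Motzkin trees with $n$ vertices. Let $R'_k(x)=\sum_{n\ge 1} r'_k(n)x^n$, where $r'_k(n)$ is the number of Motzkin trees with $n$ vertices whose root has exactly $k$ leaves in its subtree (i.e. the tree has $k$ leaves). Then, as formal power series, $$L_k(x)=\frac{R'_k(x)}{\sqrt{1-2x-3x^2}}.$$
   Context: A Motzkin tree is a rooted planar (ordered) tree in which every non-leaf vertex has either one or two children; its size is its number of vertices. The subtree of a vertex $v$ consists of $v$ together with all of its descendants. The square root denotes the formal power series with constant term $1$. -}

module Defs where

open import Data.Nat using (ℕ; zero; suc; _+_; _∸_; _≟_)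
open import Data.Integer as ℤ using (ℤ; +_; -[1+_])
open import Data.List using (List; []; _∷_; _++_; map; concatMap; filter; length; upTo)
open import Data.Nat.ListAction using (sum)
open import Relation.Nullary using (yes; no)

data Motzkin : Set where
  leaf   : Motzkin
  unary  : Motzkin → Motzkin
  binary : Motzkin → Motzkin → Motzkin

size : Motzkin → ℕ
size leaf         = 1
size (unary t)    = suc (size t)
size (binary l r) = suc (size l + size r)

leaves : Motzkin → ℕ
leaves leaf         = 1
leaves (unary t)    = leaves t
leaves (binary l r) = leaves l + leaves r

vertsWithLeaves : ℕ → Motzkin → ℕ
vertsWithLeaves k t = here t + below t
  where
  here : Motzkin → ℕ
  here s with leaves s ≟ k
  ... | yes _ = 1
  ... | no  _ = 0
  below : Motzkin → ℕ
  below leaf         = 0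
  below (unary s)    = vertsWithLeaves k s
  below (binary l r) = vertsWithLeaves k l + vertsWithLeaves k r

-- all Motzkin trees of height at most d (height counted in vertices on a
-- longest root-to-leaf path), each listed exactly once
treesOfHeight≤ : ℕ → List Motzkin
treesOfHeight≤ zero    = []
treesOfHeight≤ (suc d) =
  leaf ∷ (map unary (treesOfHeight≤ d)
          ++ concatMap (λ l → map (binary l) (treesOfHeight≤ d)) (treesOfHeight≤ d))

-- all Motzkin trees with exactly n vertices (a tree with n vertices has height ≤ n)
treesOfSize : ℕ → List Motzkin
treesOfSize n = filter (λ t → size t ≟ n) (treesOfHeight≤ n)

ℓ : ℕ → ℕ → ℕ
ℓ k n = sum (map (vertsWithLeaves k) (treesOfSize n))

r′ : ℕ → ℕ → ℕ
r′ k n = length (filter (λ t → leaves t ≟ k) (treesOfSize n))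

PowerSeries : Set
PowerSeries = ℕ → ℤ

sumℤ : List ℤ → ℤ
sumℤ []       = + 0
sumℤ (x ∷ xs) = x ℤ.+ sumℤ xs

_⊛_ : PowerSeries → PowerSeries → PowerSeries
(f ⊛ g) n = sumℤ (map (λ i → f i ℤ.* g (n ∸ i)) (upTo (suc n)))

ofℕ : (ℕ → ℕ) → PowerSeries
ofℕ a n = + (a n)

oneMinus2xMinus3x² : PowerSeries
oneMinus2xMinus3x² 0 = + 1
oneMinus2xMinus3x² 1 = -[1+ 1 ]
oneMinus2xMinus3x² 2 = -[1+ 2 ]
oneMinus2xMinus3x² (suc (suc (suc _))) = + 0

L : ℕ → PowerSeries
L k = ofℕ (ℓ k)

R′ : ℕ → PowerSeries
R′ k = ofℕ (r′ k)

-- Cutting a Motzkin tree at its root shows that the Motzkin series M = Σ m(n) xⁿ satisfies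
-- M = x (1 + M + M²), and, since a vertex whose subtree has k leaves is either the root or a
-- vertex of one of the root's subtrees, that L_k = R'_k + x (L_k + 2 L_k M).  Hence
-- L_k (1 − x − 2xM) = R'_k.  Completing the square in the equation for M gives
-- (1 − x − 2xM)² = 1 − 2x − 3x², and over ℤ a power series S with S(0) = 1 is determined
-- by S², because S² − T² = (S − T)(S + T) and S + T has nonzero constant term.

module Submission where

open import Defs
open import Data.Bool using (Bool; true; false)
open import Data.Integer using (ℤ; +_; _+_; _-_; _*_; -_)
open import Data.Integer.Properties
  using (+-identityˡ; +-identityʳ; +-comm; +-assoc; *-comm; *-assoc; *-zeroˡ; *-zeroʳ;
         *-identityˡ; *-identityʳ; *-distribˡ-+; pos-+; i*j≡0⇒i≡0∨j≡0; i-j≡0⇒i≡j)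
open import Data.Integer.Tactic.RingSolver using (solve-∀)
open import Data.List using (List; []; _∷_; _++_; [_]; map; concatMap; filter; length; upTo)
open import Data.List.Properties using (map-cong; map-cong-local; map-applyUpTo; map-upTo; upTo-∷ʳ)
open import Data.List.Relation.Unary.All.Properties using (applyUpTo⁺₁)
open import Data.Nat as ℕ using (ℕ; zero; suc; _≟_; _≥_; _∸_; _<_; _≤_; _≤′_; ≤′-refl; ≤′-step; _≡ᵇ_; s≤s)
open import Data.Nat.ListAction using (sum)
open import Data.Nat.Properties using (n∸n≡0; +-∸-assoc; ≤-pred; ≤-refl; ≤-trans; m∸n≤m; ≤⇒≤′; ≤′⇒≤)
open import Data.Nat.Induction using (<-rec)
open import Data.Empty using (⊥-elim)
open import Data.Sum using (inj₁; inj₂)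
open import Function using (_∘_)
open import Relation.Binary.PropositionalEquality using (_≡_; _≢_; refl; sym; trans; cong; cong₂; _≗_; module ≡-Reasoning)
open import Relation.Nullary using (does; yes; no)
open import Relation.Nullary.Decidable using (dec-true; dec-false)
open import Relation.Unary using (Pred; Decidable)
open ≡-Reasoning

private variable
  A : Set

∑ : List A → (A → ℤ) → ℤ
∑ xs f = sumℤ (map f xs)

infix 5 ∑
syntax ∑ xs (λ x → e) = ∑[ x ∈ xs ] e

∑-cong : ∀ (xs : List A) {f g : A → ℤ} → f ≗ g → ∑ xs f ≡ ∑ xs g
∑-cong xs f≗g = cong sumℤ (map-cong f≗g xs)

∑-cong-upTo : ∀ n {f g : ℕ → ℤ} → (∀ {i} → i < n → f i ≡ g i) → ∑ (upTo n) f ≡ ∑ (upTo n) g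
∑-cong-upTo n f≡g = cong sumℤ (map-cong-local (applyUpTo⁺₁ (λ i → i) n f≡g))

∑-++ : ∀ (xs ys : List A) f → ∑ (xs ++ ys) f ≡ ∑ xs f + ∑ ys f
∑-++ []       ys f = sym (+-identityˡ (∑ ys f))
∑-++ (x ∷ xs) ys f = trans (cong (_+_ (f x)) (∑-++ xs ys f)) (sym (+-assoc (f x) _ _))

∑-map : ∀ {B : Set} (g : A → B) (xs : List A) f → ∑ (map g xs) f ≡ ∑ xs (f ∘ g)
∑-map g []       f = refl
∑-map g (x ∷ xs) f = cong (_+_ (f (g x))) (∑-map g xs f)

∑-concatMap : ∀ {B : Set} (g : A → List B) (xs : List A) f →
  ∑ (concatMap g xs) f ≡ ∑[ x ∈ xs ] ∑ (g x) f
∑-concatMap g []       f = refl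
∑-concatMap g (x ∷ xs) f =
  trans (∑-++ (g x) (concatMap g xs) f) (cong (_+_ (∑ (g x) f)) (∑-concatMap g xs f))

∑-zero : ∀ (xs : List A) → (∑[ x ∈ xs ] + 0) ≡ + 0
∑-zero []       = refl
∑-zero (x ∷ xs) = trans (+-identityˡ _) (∑-zero xs)

∑-+ : ∀ (xs : List A) f g → ∑[ x ∈ xs ] (f x + g x) ≡ ∑ xs f + ∑ xs g
∑-+ []       f g = refl
∑-+ (x ∷ xs) f g = trans (cong (_+_ (f x + g x)) (∑-+ xs f g)) (swap (f x) (g x) _ _)
  where
  swap : ∀ a b c d → a + b + (c + d) ≡ a + c + (b + d)
  swap = solve-∀

∑-- : ∀ (xs : List A) f g → ∑[ x ∈ xs ] (f x - g x) ≡ ∑ xs f - ∑ xs g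
∑-- []       f g = refl
∑-- (x ∷ xs) f g = trans (cong (_+_ (f x - g x)) (∑-- xs f g)) (swap (f x) (g x) _ _)
  where
  swap : ∀ a b c d → a - b + (c - d) ≡ a + c - (b + d)
  swap = solve-∀

∑-*ˡ : ∀ (xs : List A) c f → ∑[ x ∈ xs ] (c * f x) ≡ c * ∑ xs f
∑-*ˡ []       c f = sym (*-zeroʳ c)
∑-*ˡ (x ∷ xs) c f = trans (cong (_+_ (c * f x)) (∑-*ˡ xs c f)) (sym (*-distribˡ-+ c (f x) _))

∑-*ʳ : ∀ (xs : List A) c f → ∑[ x ∈ xs ] (f x * c) ≡ ∑ xs f * c
∑-*ʳ xs c f = trans (∑-cong xs (λ x → *-comm (f x) c)) (trans (∑-*ˡ xs c f) (*-comm c _))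

∑-comm : ∀ {B : Set} (xs : List A) (ys : List B) (h : A → B → ℤ) →
  ∑[ x ∈ xs ] ∑[ y ∈ ys ] h x y ≡ ∑[ y ∈ ys ] ∑[ x ∈ xs ] h x y
∑-comm []       ys h = sym (∑-zero ys)
∑-comm (x ∷ xs) ys h = begin
  ∑ ys (h x) + (∑[ x′ ∈ xs ] ∑ ys (h x′))        ≡⟨ cong (_+_ (∑ ys (h x))) (∑-comm xs ys h) ⟩
  ∑ ys (h x) + (∑[ y ∈ ys ] ∑[ x′ ∈ xs ] h x′ y)  ≡⟨ sym (∑-+ ys (h x) _) ⟩
  ∑[ y ∈ ys ] (h x y + (∑[ x′ ∈ xs ] h x′ y))      ∎

∑-upTo-head : ∀ n (f : ℕ → ℤ) → ∑ (upTo (suc n)) f ≡ f 0 + ∑ (upTo n) (f ∘ suc)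
∑-upTo-head n f = cong (λ xs → f 0 + sumℤ xs)
  (trans (map-applyUpTo suc f n) (sym (map-upTo (f ∘ suc) n)))

∑-upTo-last : ∀ n (f : ℕ → ℤ) → ∑ (upTo (suc n)) f ≡ ∑ (upTo n) f + f n
∑-upTo-last n f = begin
  ∑ (upTo (suc n)) f       ≡⟨ cong (λ xs → ∑ xs f) (sym (upTo-∷ʳ n)) ⟩
  ∑ (upTo n ++ [ n ]) f    ≡⟨ ∑-++ (upTo n) [ n ] f ⟩
  ∑ (upTo n) f + (f n + + 0) ≡⟨ cong (_+_ (∑ (upTo n) f)) (+-identityʳ (f n)) ⟩
  ∑ (upTo n) f + f n       ∎

𝟙 : PowerSeries
𝟙 zero    = + 1
𝟙 (suc _) = + 0

infixl 6 _⊕_ _⊝_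
infixr 7 _·ₛ_ x·_

_⊕_ _⊝_ : PowerSeries → PowerSeries → PowerSeries
(f ⊕ g) n = f n + g n
(f ⊝ g) n = f n - g n

_·ₛ_ : ℤ → PowerSeries → PowerSeries
(c ·ₛ f) n = c * f n

x·_ : PowerSeries → PowerSeries
(x· f) zero    = + 0
(x· f) (suc n) = f n

⊛-cong : ∀ {f f′ g g′} → f ≗ f′ → g ≗ g′ → f ⊛ g ≗ f′ ⊛ g′
⊛-cong f≗f′ g≗g′ n = ∑-cong (upTo (suc n)) (λ i → cong₂ _*_ (f≗f′ i) (g≗g′ (n ∸ i)))

⊛-splitHead : ∀ f g n → (f ⊛ g) (suc n) ≡ f 0 * g (suc n) + ((f ∘ suc) ⊛ g) n
⊛-splitHead f g n = ∑-upTo-head (suc n) (λ i → f i * g (suc n ∸ i))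

⊛-splitLast : ∀ f g n → (f ⊛ g) n ≡ (∑[ i ∈ upTo n ] f i * g (n ∸ i)) + f n * g 0
⊛-splitLast f g n = begin
  (f ⊛ g) n
    ≡⟨ ∑-upTo-last n (λ i → f i * g (n ∸ i)) ⟩
  (∑[ i ∈ upTo n ] f i * g (n ∸ i)) + f n * g (n ∸ n)
    ≡⟨ cong (λ m → (∑[ i ∈ upTo n ] f i * g (n ∸ i)) + f n * g m) (n∸n≡0 n) ⟩
  (∑[ i ∈ upTo n ] f i * g (n ∸ i)) + f n * g 0 ∎

⊛-splitLast-suc : ∀ f g n → (f ⊛ g) (suc n) ≡ (f ⊛ (g ∘ suc)) n + f (suc n) * g 0
⊛-splitLast-suc f g n = trans (⊛-splitLast f g (suc n))
  (cong (_+ f (suc n) * g 0) (∑-cong-upTo (suc n) (λ {i} i<1+n →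
    cong (λ m → f i * g m) (+-∸-assoc 1 (≤-pred i<1+n)))))

⊛-comm : ∀ f g → f ⊛ g ≗ g ⊛ f
⊛-comm f g zero    = cong (_+ + 0) (*-comm (f 0) (g 0))
⊛-comm f g (suc n) = begin
  (f ⊛ g) (suc n)
    ≡⟨ ⊛-splitHead f g n ⟩
  f 0 * g (suc n) + ((f ∘ suc) ⊛ g) n
    ≡⟨ cong (_+_ (f 0 * g (suc n))) (⊛-comm (f ∘ suc) g n) ⟩
  f 0 * g (suc n) + (g ⊛ (f ∘ suc)) n
    ≡⟨ +-comm (f 0 * g (suc n)) _ ⟩
  (g ⊛ (f ∘ suc)) n + f 0 * g (suc n)
    ≡⟨ cong (_+_ ((g ⊛ (f ∘ suc)) n)) (*-comm (f 0) (g (suc n))) ⟩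
  (g ⊛ (f ∘ suc)) n + g (suc n) * f 0
    ≡⟨ sym (⊛-splitLast-suc g f n) ⟩
  (g ⊛ f) (suc n) ∎

⊛-distribˡ-⊕ : ∀ f g h → f ⊛ (g ⊕ h) ≗ f ⊛ g ⊕ f ⊛ h
⊛-distribˡ-⊕ f g h n = trans
  (∑-cong (upTo (suc n)) (λ i → *-distribˡ-+ (f i) (g (n ∸ i)) (h (n ∸ i))))
  (∑-+ (upTo (suc n)) (λ i → f i * g (n ∸ i)) (λ i → f i * h (n ∸ i)))

⊛-distribˡ-⊝ : ∀ f g h → f ⊛ (g ⊝ h) ≗ f ⊛ g ⊝ f ⊛ h
⊛-distribˡ-⊝ f g h n = trans
  (∑-cong (upTo (suc n)) (λ i → distrib (f i) (g (n ∸ i)) (h (n ∸ i))))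
  (∑-- (upTo (suc n)) (λ i → f i * g (n ∸ i)) (λ i → f i * h (n ∸ i)))
  where
  distrib : ∀ a b c → a * (b - c) ≡ a * b - a * c
  distrib = solve-∀

⊛-distribʳ-⊝ : ∀ f g h → (f ⊝ g) ⊛ h ≗ f ⊛ h ⊝ g ⊛ h
⊛-distribʳ-⊝ f g h n = begin
  ((f ⊝ g) ⊛ h) n          ≡⟨ ⊛-comm (f ⊝ g) h n ⟩
  (h ⊛ (f ⊝ g)) n          ≡⟨ ⊛-distribˡ-⊝ h f g n ⟩
  (h ⊛ f) n - (h ⊛ g) n    ≡⟨ cong₂ _-_ (⊛-comm h f n) (⊛-comm h g n) ⟩
  (f ⊛ h) n - (g ⊛ h) n    ∎

⊛-scalarˡ : ∀ c f g → (c ·ₛ f) ⊛ g ≗ c ·ₛ (f ⊛ g)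
⊛-scalarˡ c f g n = trans
  (∑-cong (upTo (suc n)) (λ i → *-assoc c (f i) (g (n ∸ i))))
  (∑-*ˡ (upTo (suc n)) c (λ i → f i * g (n ∸ i)))

⊛-scalarʳ : ∀ c f g → f ⊛ (c ·ₛ g) ≗ c ·ₛ (f ⊛ g)
⊛-scalarʳ c f g n =
  trans (⊛-comm f (c ·ₛ g) n) (trans (⊛-scalarˡ c g f n) (cong (c *_) (⊛-comm g f n)))

⊛-identityˡ : ∀ f → 𝟙 ⊛ f ≗ f
⊛-identityˡ f zero    = trans (+-identityʳ _) (*-identityˡ (f 0))
⊛-identityˡ f (suc n) = begin
  (𝟙 ⊛ f) (suc n)
    ≡⟨ ⊛-splitHead 𝟙 f n ⟩
  + 1 * f (suc n) + ((𝟙 ∘ suc) ⊛ f) n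
    ≡⟨ cong₂ _+_ (*-identityˡ (f (suc n))) vanish ⟩
  f (suc n) + + 0
    ≡⟨ +-identityʳ _ ⟩
  f (suc n) ∎
  where
  vanish : ((𝟙 ∘ suc) ⊛ f) n ≡ + 0
  vanish = trans (∑-cong (upTo (suc n)) (λ i → *-zeroˡ (f (n ∸ i)))) (∑-zero (upTo (suc n)))

⊛-identityʳ : ∀ f → f ⊛ 𝟙 ≗ f
⊛-identityʳ f n = trans (⊛-comm f 𝟙 n) (⊛-identityˡ f n)

x·-⊛-suc : ∀ f g n → ((x· f) ⊛ g) (suc n) ≡ (f ⊛ g) n
x·-⊛-suc f g n = trans (⊛-splitHead (x· f) g n) (+-identityˡ _)

⊛-vanishing-below : ∀ f g n → (∀ {i} → i < n → f i ≡ + 0) → (f ⊛ g) n ≡ f n * g 0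
⊛-vanishing-below f g n f<n≡0 = begin
  (f ⊛ g) n                                        ≡⟨ ⊛-splitLast f g n ⟩
  (∑[ i ∈ upTo n ] f i * g (n ∸ i)) + f n * g 0    ≡⟨ cong (_+ f n * g 0) lower≡0 ⟩
  + 0 + f n * g 0                                  ≡⟨ +-identityˡ _ ⟩
  f n * g 0                                        ∎
  where
  lower≡0 : (∑[ i ∈ upTo n ] f i * g (n ∸ i)) ≡ + 0
  lower≡0 = trans (∑-cong-upTo n (λ {i} i<n → cong (_* g (n ∸ i)) (f<n≡0 i<n)))
                  (trans (∑-cong (upTo n) (λ i → *-zeroˡ (g (n ∸ i)))) (∑-zero (upTo n)))

f⊛g≡0⇒f≡0 : ∀ f g → g 0 ≢ + 0 → (∀ n → (f ⊛ g) n ≡ + 0) → ∀ n → f n ≡ + 0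
f⊛g≡0⇒f≡0 f g g₀≢0 f⊛g≡0 = <-rec (λ n → f n ≡ + 0) step
  where
  step : ∀ n → (∀ {m} → m < n → f m ≡ + 0) → f n ≡ + 0
  step n f<n≡0
    with i*j≡0⇒i≡0∨j≡0 (f n) (trans (sym (⊛-vanishing-below f g n f<n≡0)) (f⊛g≡0 n))
  ... | inj₁ fₙ≡0 = fₙ≡0
  ... | inj₂ g₀≡0 = ⊥-elim (g₀≢0 g₀≡0)

⊛-square-injective : ∀ f g → f 0 + g 0 ≢ + 0 → (∀ n → (f ⊛ f) n ≡ (g ⊛ g) n) → f ≗ g
⊛-square-injective f g f₀+g₀≢0 f²≡g² n =
  i-j≡0⇒i≡j (f n) (g n) (f⊛g≡0⇒f≡0 (f ⊝ g) (f ⊕ g) f₀+g₀≢0 difference-of-squares n)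
  where
  difference-of-squares : ∀ n → ((f ⊝ g) ⊛ (f ⊕ g)) n ≡ + 0
  difference-of-squares n = begin
    ((f ⊝ g) ⊛ (f ⊕ g)) n
      ≡⟨ ⊛-distribʳ-⊝ f g (f ⊕ g) n ⟩
    (f ⊛ (f ⊕ g)) n - (g ⊛ (f ⊕ g)) n
      ≡⟨ cong₂ _-_ (⊛-distribˡ-⊕ f f g n) (⊛-distribˡ-⊕ g f g n) ⟩
    (f ⊛ f) n + (f ⊛ g) n - ((g ⊛ f) n + (g ⊛ g) n)
      ≡⟨ cong₂ (λ a b → a + (f ⊛ g) n - (b + (g ⊛ g) n)) (f²≡g² n) (⊛-comm g f n) ⟩
    (g ⊛ g) n + (f ⊛ g) n - ((f ⊛ g) n + (g ⊛ g) n)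
      ≡⟨ cancel ((g ⊛ g) n) ((f ⊛ g) n) ⟩
    + 0 ∎
    where
    cancel : ∀ a b → a + b - (b + a) ≡ + 0
    cancel = solve-∀

⟦_⟧ : Bool → ℤ
⟦ true ⟧  = + 1
⟦ false ⟧ = + 0

∑-filter : ∀ {p} {P : Pred A p} (P? : Decidable P) xs f →
  ∑ (filter P? xs) f ≡ ∑[ x ∈ xs ] ⟦ does (P? x) ⟧ * f x
∑-filter P? []       f = refl
∑-filter P? (x ∷ xs) f with does (P? x)
... | true  = cong₂ _+_ (sym (*-identityˡ (f x))) (∑-filter P? xs f)
... | false = trans (∑-filter P? xs f) (sym (+-identityˡ _))

∑-⟦≡ᵇ⟧-convolution : ∀ s m n →
  (∑[ a ∈ upTo (suc n) ] ⟦ s ≡ᵇ a ⟧ * ⟦ m ≡ᵇ n ∸ a ⟧) ≡ ⟦ s ℕ.+ m ≡ᵇ n ⟧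
∑-⟦≡ᵇ⟧-convolution zero m n = begin
  (∑[ a ∈ upTo (suc n) ] ⟦ 0 ≡ᵇ a ⟧ * ⟦ m ≡ᵇ n ∸ a ⟧)
    ≡⟨ ∑-upTo-head n (λ a → ⟦ 0 ≡ᵇ a ⟧ * ⟦ m ≡ᵇ n ∸ a ⟧) ⟩
  + 1 * ⟦ m ≡ᵇ n ⟧ + (∑[ a ∈ upTo n ] + 0 * ⟦ m ≡ᵇ n ∸ suc a ⟧)
    ≡⟨ cong₂ _+_ (*-identityˡ ⟦ m ≡ᵇ n ⟧) (∑-zero (upTo n)) ⟩
  ⟦ m ≡ᵇ n ⟧ + + 0
    ≡⟨ +-identityʳ _ ⟩
  ⟦ m ≡ᵇ n ⟧ ∎
∑-⟦≡ᵇ⟧-convolution (suc s) m zero    = refl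
∑-⟦≡ᵇ⟧-convolution (suc s) m (suc n) = begin
  (∑[ a ∈ upTo (suc (suc n)) ] ⟦ suc s ≡ᵇ a ⟧ * ⟦ m ≡ᵇ suc n ∸ a ⟧)
    ≡⟨ ∑-upTo-head (suc n) (λ a → ⟦ suc s ≡ᵇ a ⟧ * ⟦ m ≡ᵇ suc n ∸ a ⟧) ⟩
  + 0 * ⟦ m ≡ᵇ suc n ⟧ + (∑[ a ∈ upTo (suc n) ] ⟦ s ≡ᵇ a ⟧ * ⟦ m ≡ᵇ n ∸ a ⟧)
    ≡⟨ +-identityˡ _ ⟩
  (∑[ a ∈ upTo (suc n) ] ⟦ s ≡ᵇ a ⟧ * ⟦ m ≡ᵇ n ∸ a ⟧)
    ≡⟨ ∑-⟦≡ᵇ⟧-convolution s m n ⟩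
  ⟦ s ℕ.+ m ≡ᵇ n ⟧ ∎

∑∑-by-total-weight : ∀ {B : Set} (u : A → ℕ) (v : B → ℕ) xs ys (h : A → B → ℤ) n →
  (∑[ a ∈ upTo (suc n) ] ∑[ x ∈ xs ] ⟦ u x ≡ᵇ a ⟧ * (∑[ y ∈ ys ] ⟦ v y ≡ᵇ n ∸ a ⟧ * h x y))
  ≡ (∑[ x ∈ xs ] ∑[ y ∈ ys ] ⟦ u x ℕ.+ v y ≡ᵇ n ⟧ * h x y)
∑∑-by-total-weight u v xs ys h n = begin
  (∑[ a ∈ range ] ∑[ x ∈ xs ] ⟦ u x ≡ᵇ a ⟧ * (∑[ y ∈ ys ] ⟦ v y ≡ᵇ n ∸ a ⟧ * h x y))
    ≡⟨ ∑-comm range xs _ ⟩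
  (∑[ x ∈ xs ] ∑[ a ∈ range ] ⟦ u x ≡ᵇ a ⟧ * (∑[ y ∈ ys ] ⟦ v y ≡ᵇ n ∸ a ⟧ * h x y))
    ≡⟨ ∑-cong xs (λ x → ∑-cong range (λ a → sym (∑-*ˡ ys ⟦ u x ≡ᵇ a ⟧ _))) ⟩
  (∑[ x ∈ xs ] ∑[ a ∈ range ] ∑[ y ∈ ys ] ⟦ u x ≡ᵇ a ⟧ * (⟦ v y ≡ᵇ n ∸ a ⟧ * h x y))
    ≡⟨ ∑-cong xs (λ x → ∑-comm range ys _) ⟩
  (∑[ x ∈ xs ] ∑[ y ∈ ys ] ∑[ a ∈ range ] ⟦ u x ≡ᵇ a ⟧ * (⟦ v y ≡ᵇ n ∸ a ⟧ * h x y))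
    ≡⟨ ∑-cong xs (λ x → ∑-cong ys (λ y → collect x y)) ⟩
  (∑[ x ∈ xs ] ∑[ y ∈ ys ] ⟦ u x ℕ.+ v y ≡ᵇ n ⟧ * h x y)
    ∎
  where
  range = upTo (suc n)
  collect : ∀ x y →
    (∑[ a ∈ range ] ⟦ u x ≡ᵇ a ⟧ * (⟦ v y ≡ᵇ n ∸ a ⟧ * h x y)) ≡ ⟦ u x ℕ.+ v y ≡ᵇ n ⟧ * h x y
  collect x y = begin
    (∑[ a ∈ range ] ⟦ u x ≡ᵇ a ⟧ * (⟦ v y ≡ᵇ n ∸ a ⟧ * h x y))
      ≡⟨ ∑-cong range (λ a → sym (*-assoc ⟦ u x ≡ᵇ a ⟧ _ _)) ⟩
    (∑[ a ∈ range ] ⟦ u x ≡ᵇ a ⟧ * ⟦ v y ≡ᵇ n ∸ a ⟧ * h x y)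
      ≡⟨ ∑-*ʳ range (h x y) (λ a → ⟦ u x ≡ᵇ a ⟧ * ⟦ v y ≡ᵇ n ∸ a ⟧) ⟩
    (∑[ a ∈ range ] ⟦ u x ≡ᵇ a ⟧ * ⟦ v y ≡ᵇ n ∸ a ⟧) * h x y
      ≡⟨ cong (_* h x y) (∑-⟦≡ᵇ⟧-convolution (u x) (v y) n) ⟩
    ⟦ u x ℕ.+ v y ≡ᵇ n ⟧ * h x y ∎

⟦0≡ᵇ⟧≡𝟙 : ∀ n → ⟦ 0 ≡ᵇ n ⟧ ≡ 𝟙 n
⟦0≡ᵇ⟧≡𝟙 zero    = refl
⟦0≡ᵇ⟧≡𝟙 (suc n) = refl

gf : (Motzkin → ℤ) → PowerSeries
gf f n = ∑[ t ∈ treesOfSize n ] f t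

-- treesOfSize n enumerates the trees of height ≤ n; the size-n part of treesOfHeight≤ d is
-- independent of d ≥ n (gfₕ-stable), which is what lets the subtrees be counted by their size.
gfₕ : ℕ → (Motzkin → ℤ) → PowerSeries
gfₕ d f n = ∑[ t ∈ treesOfHeight≤ d ] ⟦ size t ≡ᵇ n ⟧ * f t

-- For G = gf, pairs G h n is the sum of h l r over all pairs of trees with size l + size r ≡ n.
pairs : ((Motzkin → ℤ) → PowerSeries) → (Motzkin → Motzkin → ℤ) → PowerSeries
pairs G h n = ∑[ a ∈ upTo (suc n) ] G (λ l → G (h l) (n ∸ a)) a

splitAtRoot : ((Motzkin → ℤ) → PowerSeries) → (Motzkin → ℤ) → PowerSeries
splitAtRoot G f zero    = + 0
splitAtRoot G f (suc n) = 𝟙 n * f leaf + (G (f ∘ unary) n + pairs G (λ l r → f (binary l r)) n)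

gf≡gfₕ : ∀ f n → gf f n ≡ gfₕ n f n
gf≡gfₕ f n = ∑-filter (λ t → size t ≟ n) (treesOfHeight≤ n) f

gfₕ-cong : ∀ d {f g} → f ≗ g → gfₕ d f ≗ gfₕ d g
gfₕ-cong d f≗g n = ∑-cong (treesOfHeight≤ d) (λ t → cong (⟦ size t ≡ᵇ n ⟧ *_) (f≗g t))

gfₕ-zero : ∀ d f → gfₕ d f 0 ≡ + 0
gfₕ-zero d f =
  trans (∑-cong (treesOfHeight≤ d) (λ t → cong (_* f t) (size≢0 t))) (∑-zero (treesOfHeight≤ d))
  where
  size≢0 : ∀ t → ⟦ size t ≡ᵇ 0 ⟧ ≡ + 0
  size≢0 leaf         = refl
  size≢0 (unary t)    = refl
  size≢0 (binary l r) = refl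

gfₕ-suc : ∀ d f → gfₕ (suc d) f ≗ splitAtRoot (gfₕ d) f
gfₕ-suc d f zero    = gfₕ-zero (suc d) f
gfₕ-suc d f (suc n) = cong₂ _+_ (cong (_* f leaf) (⟦0≡ᵇ⟧≡𝟙 n)) (begin
  ∑ (map unary T ++ concatMap (λ l → map (binary l) T) T) w
    ≡⟨ ∑-++ (map unary T) _ w ⟩
  ∑ (map unary T) w + ∑ (concatMap (λ l → map (binary l) T) T) w
    ≡⟨ cong₂ _+_ (∑-map unary T w) (∑-concatMap (λ l → map (binary l) T) T w) ⟩
  gfₕ d (f ∘ unary) n + (∑[ l ∈ T ] ∑ (map (binary l) T) w)
    ≡⟨ cong (_+_ (gfₕ d (f ∘ unary) n)) (∑-cong T (λ l → ∑-map (binary l) T w)) ⟩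
  gfₕ d (f ∘ unary) n + (∑[ l ∈ T ] ∑[ r ∈ T ] ⟦ size l ℕ.+ size r ≡ᵇ n ⟧ * f (binary l r))
    ≡⟨ cong (_+_ (gfₕ d (f ∘ unary) n)) (sym (∑∑-by-total-weight size size T T (λ l r → f (binary l r)) n)) ⟩
  gfₕ d (f ∘ unary) n + pairs (gfₕ d) (λ l r → f (binary l r)) n
    ∎)
  where
  T = treesOfHeight≤ d
  w : Motzkin → ℤ
  w t = ⟦ size t ≡ᵇ suc n ⟧ * f t

splitAtRoot-cong : ∀ {G G′ : (Motzkin → ℤ) → PowerSeries} → (∀ {f g} → f ≗ g → G f ≗ G g) →
  ∀ n → (∀ {m} → m < n → ∀ f → G f m ≡ G′ f m) → ∀ f → splitAtRoot G f n ≡ splitAtRoot G′ f n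
splitAtRoot-cong G-cong zero    G≡G′ f = refl
splitAtRoot-cong {G} {G′} G-cong (suc n) G≡G′ f =
  cong (_+_ (𝟙 n * f leaf)) (cong₂ _+_ (G≡G′ ≤-refl (f ∘ unary)) pairs≡)
  where
  h : Motzkin → Motzkin → ℤ
  h l r = f (binary l r)
  pairs≡ : pairs G h n ≡ pairs G′ h n
  pairs≡ = ∑-cong-upTo (suc n) λ {a} a<1+n →
    trans (G-cong (λ l → G≡G′ (s≤s (m∸n≤m n a)) (h l)) a) (G≡G′ a<1+n _)

gfₕ-stable-step : ∀ d f n → n ≤ d → gfₕ d f n ≡ gfₕ (suc d) f n
gfₕ-stable-step zero    f zero _    = sym (gfₕ-zero 1 f)
gfₕ-stable-step (suc d) f n  n≤1+d = begin
  gfₕ (suc d) f n                ≡⟨ gfₕ-suc d f n ⟩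
  splitAtRoot (gfₕ d) f n        ≡⟨ splitAtRoot-cong (gfₕ-cong d) n below f ⟩
  splitAtRoot (gfₕ (suc d)) f n  ≡⟨ gfₕ-suc (suc d) f n ⟨
  gfₕ (suc (suc d)) f n          ∎
  where
  below : ∀ {m} → m < n → ∀ g → gfₕ d g m ≡ gfₕ (suc d) g m
  below m<n g = gfₕ-stable-step d g _ (≤-pred (≤-trans m<n n≤1+d))

gfₕ-stable : ∀ {n d} f → n ≤′ d → gfₕ n f n ≡ gfₕ d f n
gfₕ-stable f ≤′-refl       = refl
gfₕ-stable f (≤′-step n≤d) = trans (gfₕ-stable f n≤d) (gfₕ-stable-step _ f _ (≤′⇒≤ n≤d))

gf-splitAtRoot : ∀ f → gf f ≗ splitAtRoot gf f
gf-splitAtRoot f zero    = refl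
gf-splitAtRoot f (suc n) = begin
  gf f (suc n)                    ≡⟨ gf≡gfₕ f (suc n) ⟩
  gfₕ (suc n) f (suc n)           ≡⟨ gfₕ-suc n f (suc n) ⟩
  splitAtRoot (gfₕ n) f (suc n)   ≡⟨ splitAtRoot-cong (gfₕ-cong n) (suc n) below f ⟩
  splitAtRoot gf f (suc n)        ∎
  where
  below : ∀ {m} → m < suc n → ∀ g → gfₕ n g m ≡ gf g m
  below {m} m<1+n g = sym (trans (gf≡gfₕ g m) (gfₕ-stable g (≤⇒≤′ (≤-pred m<1+n))))

gf-cong : ∀ {f g} → f ≗ g → gf f ≗ gf g
gf-cong f≗g n = ∑-cong (treesOfSize n) f≗g

gf-+ : ∀ f g → gf (λ t → f t + g t) ≗ gf f ⊕ gf g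
gf-+ f g n = ∑-+ (treesOfSize n) f g

pairs-+ : ∀ h h′ → pairs gf (λ l r → h l r + h′ l r) ≗ pairs gf h ⊕ pairs gf h′
pairs-+ h h′ n = trans
  (∑-cong (upTo (suc n)) λ a →
    trans (gf-cong (λ l → gf-+ (h l) (h′ l) (n ∸ a)) a) (gf-+ (H a) (H′ a) a))
  (∑-+ (upTo (suc n)) (λ a → gf (H a) a) (λ a → gf (H′ a) a))
  where
  H H′ : ℕ → Motzkin → ℤ
  H  a l = gf (h l) (n ∸ a)
  H′ a l = gf (h′ l) (n ∸ a)

pairs-product : ∀ {h} g g′ → (∀ l r → h l r ≡ g l * g′ r) → pairs gf h ≗ gf g ⊛ gf g′
pairs-product {h} g g′ h≡gg′ n = ∑-cong (upTo (suc n)) λ a → begin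
  gf (λ l → gf (h l) (n ∸ a)) a
    ≡⟨ gf-cong (λ l → trans (gf-cong (h≡gg′ l) (n ∸ a)) (∑-*ˡ (treesOfSize (n ∸ a)) (g l) g′)) a ⟩
  gf (λ l → g l * gf g′ (n ∸ a)) a
    ≡⟨ ∑-*ʳ (treesOfSize a) (gf g′ (n ∸ a)) g ⟩
  gf g a * gf g′ (n ∸ a) ∎

motzkin : PowerSeries
motzkin = gf (λ _ → + 1)

motzkin-suc : ∀ n → motzkin (suc n) ≡ 𝟙 n + (motzkin n + (motzkin ⊛ motzkin) n)
motzkin-suc n = trans (gf-splitAtRoot (λ _ → + 1) (suc n))
  (cong₂ _+_ (*-identityʳ (𝟙 n)) (cong (_+_ (motzkin n)) (pairs-product _ _ (λ _ _ → refl) n)))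

hasLeaves : ℕ → Motzkin → ℤ
hasLeaves k t = ⟦ does (leaves t ≟ k) ⟧

vertsBelow : ℕ → Motzkin → ℤ
vertsBelow k leaf         = + 0
vertsBelow k (unary t)    = + vertsWithLeaves k t
vertsBelow k (binary l r) = + vertsWithLeaves k l + + vertsWithLeaves k r

⟦≡ᵇ⟧-yes : ∀ {m n} → m ≡ n → ⟦ m ≡ᵇ n ⟧ ≡ + 1
⟦≡ᵇ⟧-yes {m} {n} m≡n = cong ⟦_⟧ (dec-true (m ≟ n) m≡n)

⟦≡ᵇ⟧-no : ∀ {m n} → m ≢ n → ⟦ m ≡ᵇ n ⟧ ≡ + 0
⟦≡ᵇ⟧-no {m} {n} m≢n = cong ⟦_⟧ (dec-false (m ≟ n) m≢n)

vertsWithLeaves-split : ∀ k t → + vertsWithLeaves k t ≡ hasLeaves k t + vertsBelow k t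
vertsWithLeaves-split k leaf with leaves leaf ≟ k
... | yes p = cong₂ _+_ (sym (⟦≡ᵇ⟧-yes p)) refl
... | no ¬p = cong₂ _+_ (sym (⟦≡ᵇ⟧-no ¬p)) refl
vertsWithLeaves-split k (unary t) with leaves t ≟ k
... | yes p = cong₂ _+_ (sym (⟦≡ᵇ⟧-yes p)) refl
... | no ¬p = cong₂ _+_ (sym (⟦≡ᵇ⟧-no ¬p)) refl
vertsWithLeaves-split k (binary l r) with leaves l ℕ.+ leaves r ≟ k
... | yes p = cong₂ _+_ (sym (⟦≡ᵇ⟧-yes p)) refl
... | no ¬p = cong₂ _+_ (sym (⟦≡ᵇ⟧-no ¬p)) refl

pos-sum : ∀ (f : A → ℕ) xs → + sum (map f xs) ≡ ∑[ x ∈ xs ] + f x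
pos-sum f []       = refl
pos-sum f (x ∷ xs) = trans (pos-+ (f x) _) (cong (_+_ (+ f x)) (pos-sum f xs))

pos-length : ∀ (xs : List A) → + length xs ≡ ∑[ x ∈ xs ] + 1
pos-length []       = refl
pos-length (x ∷ xs) = trans (pos-+ 1 (length xs)) (cong (_+_ (+ 1)) (pos-length xs))

L≗gf : ∀ k → L k ≗ gf (λ t → + vertsWithLeaves k t)
L≗gf k n = pos-sum (vertsWithLeaves k) (treesOfSize n)

R′≗gf : ∀ k → R′ k ≗ gf (hasLeaves k)
R′≗gf k n = begin
  + length (filter P? (treesOfSize n))
    ≡⟨ pos-length (filter P? (treesOfSize n)) ⟩
  (∑[ t ∈ filter P? (treesOfSize n) ] + 1)
    ≡⟨ ∑-filter P? (treesOfSize n) (λ _ → + 1) ⟩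
  (∑[ t ∈ treesOfSize n ] hasLeaves k t * + 1)
    ≡⟨ ∑-cong (treesOfSize n) (λ t → *-identityʳ (hasLeaves k t)) ⟩
  gf (hasLeaves k) n ∎
  where
  P? = λ t → leaves t ≟ k

L-suc : ∀ k n → L k (suc n) ≡ R′ k (suc n) + (L k n + ((L k ⊛ motzkin) n + (motzkin ⊛ L k) n))
L-suc k n = begin
  L k (suc n)
    ≡⟨ L≗gf k (suc n) ⟩
  gf V (suc n)
    ≡⟨ gf-cong (vertsWithLeaves-split k) (suc n) ⟩
  gf (λ t → hasLeaves k t + vertsBelow k t) (suc n)
    ≡⟨ gf-+ (hasLeaves k) (vertsBelow k) (suc n) ⟩
  gf (hasLeaves k) (suc n) + gf (vertsBelow k) (suc n)
    ≡⟨ cong₂ _+_ (R′≗gf k (suc n)) below ⟨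
  R′ k (suc n) + (L k n + ((L k ⊛ motzkin) n + (motzkin ⊛ L k) n)) ∎
  where
  V : Motzkin → ℤ
  V t = + vertsWithLeaves k t
  below : L k n + ((L k ⊛ motzkin) n + (motzkin ⊛ L k) n) ≡ gf (vertsBelow k) (suc n)
  below = begin
    L k n + ((L k ⊛ motzkin) n + (motzkin ⊛ L k) n)
      ≡⟨ cong₂ _+_ (L≗gf k n) (cong₂ _+_ (⊛-cong {g = motzkin} (L≗gf k) (λ _ → refl) n)
                                          (⊛-cong {f = motzkin} (λ _ → refl) (L≗gf k) n)) ⟩
    gf V n + ((gf V ⊛ motzkin) n + (motzkin ⊛ gf V) n)
      ≡⟨ cong (_+_ (gf V n)) (cong₂ _+_
           (pairs-product V (λ _ → + 1) (λ l r → sym (*-identityʳ (V l))) n)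
           (pairs-product (λ _ → + 1) V (λ l r → sym (*-identityˡ (V r))) n)) ⟨
    gf V n + (pairs gf (λ l r → V l) n + pairs gf (λ l r → V r) n)
      ≡⟨ cong (_+_ (gf V n)) (pairs-+ (λ l r → V l) (λ l r → V r) n) ⟨
    gf V n + pairs gf (λ l r → V l + V r) n
      ≡⟨ +-identityˡ _ ⟨
    + 0 + (gf V n + pairs gf (λ l r → V l + V r) n)
      ≡⟨ cong (_+ (gf V n + pairs gf (λ l r → V l + V r) n)) (*-zeroʳ (𝟙 n)) ⟨
    𝟙 n * + 0 + (gf V n + pairs gf (λ l r → V l + V r) n)
      ≡⟨ gf-splitAtRoot (vertsBelow k) (suc n) ⟨
    gf (vertsBelow k) (suc n)
      ∎

⊛-𝟙⊕·ₛ : ∀ f c g → f ⊛ (𝟙 ⊕ c ·ₛ g) ≗ f ⊕ c ·ₛ (f ⊛ g)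
⊛-𝟙⊕·ₛ f c g n = trans (⊛-distribˡ-⊕ f 𝟙 (c ·ₛ g) n)
  (cong₂ _+_ (⊛-identityʳ f n) (⊛-scalarʳ c f g n))

⊛-𝟙⊝x· : ∀ f g n → (f ⊛ (𝟙 ⊝ x· g)) (suc n) ≡ f (suc n) - (f ⊛ g) n
⊛-𝟙⊝x· f g n = trans (⊛-distribˡ-⊝ f 𝟙 (x· g) (suc n))
  (cong₂ _-_ (⊛-identityʳ f (suc n))
             (trans (⊛-comm f (x· g) (suc n)) (trans (x·-⊛-suc g f n) (⊛-comm g f n))))

onePlus2Motzkin : PowerSeries
onePlus2Motzkin = 𝟙 ⊕ + 2 ·ₛ motzkin

motzkinRoot : PowerSeries
motzkinRoot = 𝟙 ⊝ x· onePlus2Motzkin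

onePlus2Motzkin-suc : ∀ n → onePlus2Motzkin (suc n) ≡ + 2 * (𝟙 n + (motzkin n + (motzkin ⊛ motzkin) n))
onePlus2Motzkin-suc n = trans (+-identityˡ _) (cong (+ 2 *_) (motzkin-suc n))

onePlus2Motzkin-square : ∀ n → (onePlus2Motzkin ⊛ onePlus2Motzkin) n
  ≡ 𝟙 n + + 2 * motzkin n + + 2 * (motzkin n + + 2 * (motzkin ⊛ motzkin) n)
onePlus2Motzkin-square n = trans (⊛-𝟙⊕·ₛ W (+ 2) motzkin n)
  (cong (λ x → W n + + 2 * x) (trans (⊛-comm W motzkin n) (⊛-𝟙⊕·ₛ motzkin (+ 2) motzkin n)))
  where
  W = onePlus2Motzkin

oneMinus2xMinus3x²-suc-suc : ∀ n → oneMinus2xMinus3x² (suc (suc n)) ≡ - (+ 3 * 𝟙 n)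
oneMinus2xMinus3x²-suc-suc zero    = refl
oneMinus2xMinus3x²-suc-suc (suc n) = refl

motzkinRoot-square : ∀ n → (motzkinRoot ⊛ motzkinRoot) n ≡ oneMinus2xMinus3x² n
motzkinRoot-square zero          = refl
motzkinRoot-square (suc zero)    = refl
motzkinRoot-square (suc (suc n)) = begin
  (motzkinRoot ⊛ motzkinRoot) (suc (suc n))
    ≡⟨ ⊛-𝟙⊝x· motzkinRoot W (suc n) ⟩
  (+ 0 - W (suc n)) - (motzkinRoot ⊛ W) (suc n)
    ≡⟨ cong (_-_ (+ 0 - W (suc n))) (trans (⊛-comm motzkinRoot W (suc n)) (⊛-𝟙⊝x· W W n)) ⟩
  (+ 0 - W (suc n)) - (W (suc n) - (W ⊛ W) n)
    ≡⟨ cong₂ (λ x y → (+ 0 - x) - (x - y)) (onePlus2Motzkin-suc n) (onePlus2Motzkin-square n) ⟩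
  (+ 0 - + 2 * (e + (a + b))) - (+ 2 * (e + (a + b)) - (e + + 2 * a + + 2 * (a + + 2 * b)))
    ≡⟨ collect e a b ⟩
  - (+ 3 * e)
    ≡⟨ oneMinus2xMinus3x²-suc-suc n ⟨
  oneMinus2xMinus3x² (suc (suc n)) ∎
  where
  W = onePlus2Motzkin
  e = 𝟙 n
  a = motzkin n
  b = (motzkin ⊛ motzkin) n
  collect : ∀ e a b →
    (+ 0 - + 2 * (e + (a + b))) - (+ 2 * (e + (a + b)) - (e + + 2 * a + + 2 * (a + + 2 * b))) ≡ - (+ 3 * e)
  collect = solve-∀

L⊛motzkinRoot : ∀ k → L k ⊛ motzkinRoot ≗ R′ k
L⊛motzkinRoot k zero    = refl
L⊛motzkinRoot k (suc n) = begin
  (L k ⊛ motzkinRoot) (suc n)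
    ≡⟨ ⊛-𝟙⊝x· (L k) onePlus2Motzkin n ⟩
  L k (suc n) - (L k ⊛ onePlus2Motzkin) n
    ≡⟨ cong₂ _-_ (L-suc k n) (⊛-𝟙⊕·ₛ (L k) (+ 2) motzkin n) ⟩
  r + (l + (c + (motzkin ⊛ L k) n)) - (l + + 2 * c)
    ≡⟨ cong (λ x → r + (l + (c + x)) - (l + + 2 * c)) (⊛-comm motzkin (L k) n) ⟩
  r + (l + (c + c)) - (l + + 2 * c)
    ≡⟨ cancel r l c ⟩
  r ∎
  where
  r = R′ k (suc n)
  l = L k n
  c = (L k ⊛ motzkin) n
  cancel : ∀ r l c → r + (l + (c + c)) - (l + + 2 * c) ≡ r
  cancel = solve-∀

mainTheorem2 : (k : ℕ) → k ≥ 1 →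
    (S : PowerSeries) → S 0 ≡ + 1 → (∀ n → (S ⊛ S) n ≡ oneMinus2xMinus3x² n) →
    ∀ n → (L k ⊛ S) n ≡ R′ k n
mainTheorem2 k _ S S₀≡1 S²≡p n = begin
  (L k ⊛ S) n            ≡⟨ ⊛-cong {f = L k} (λ _ → refl) S≗motzkinRoot n ⟩
  (L k ⊛ motzkinRoot) n  ≡⟨ L⊛motzkinRoot k n ⟩
  R′ k n                 ∎
  where
  S₀+root₀≢0 : S 0 + motzkinRoot 0 ≢ + 0
  S₀+root₀≢0 rewrite S₀≡1 = λ ()
  S≗motzkinRoot : S ≗ motzkinRoot
  S≗motzkinRoot = ⊛-square-injective S motzkinRoot S₀+root₀≢0
    (λ n → trans (S²≡p n) (sym (motzkinRoot-square n)))
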